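{- The relation $\le_a$ is transitive: for all closed session types $T,V,S$, if $T\le_a V$ and $V\le_a S$ then $T\le_a S$.
   Context: Session types: $T,S ::= \&_{i\in I}?l_i(S_i).T_i \mid \bigoplus_{i\in I}!l_i\langle S_i\rangle.T_i \mid \mathbf t \mid \mu\mathbf t.T \mid \mathsf{end}$, with pairwise distinct labels in each branching/selection, closed exchanged types $S_i$ and contractive recursion; types are equi-recursive (identified when they have the same regular tree, so $\mu\mathbf t.T=T\{\mu\mathbf t.T/\mathbf t\}$). Asynchronous contexts: $\mathcal A ::= [\,]^n \mid \&_{i\in I}?l_i(S_i).\mathcal A_i$, with holes indexed by distinct indices; $\mathcal A[T_n]^{n\in N}$ denotes the context whose holes are indexed by $N$ with each hole $[\,]^n$ filled by $T_n$. Write $\&\in\mathcal A$ if $\mathcal A$ is not a single hole. The predicate $\&\in T$ (every continuation path of $T$ contains a branching) is defined inductively on possibly open types: $\&\in\&_{i\in I}?l_i(S_i).T_i$; $\&\in\bigoplus_{i\in I}!l_i\langle S_i\rangle.T_i$ if $\&\in T_i$ for all $i\in I$; $\&\in\mu\mathbf t.T$ if $\&\in T$. Asynchronous subtyping $\le_a$ is the largest (coinductively defined) relation on closed types such that $T\le_a S$ implies one of: $T=S=\mathsf{end}$; $T=\&_{i\in I\cup J}?l_i(S_i).T_i$, $S=\&_{i\in I}?l_i(S'_i).T'_i$ with $S_i\le_a S'_i$ and $T_i\le_a T'_i$ for all $i\in I$; $T=\bigoplus_{i\in I}!l_i\langle S_i\rangle.T_i$, $S=\bigoplus_{i\in I\cup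 J}!l_i\langle S'_i\rangle.T'_i$ with $S'_i\le_a S_i$ and $T_i\le_a T'_i$ for all $i\in I$; or $T=\bigoplus_{i\in I}!l_i\langle S_i\rangle.T_i$ and $S=\mathcal A[\bigoplus_{i\in I\cup J_n}!l_i\langle S^n_i\rangle.T^n_i]^{n\in N}$ for some asynchronous context $\mathcal A$ with $\&\in\mathcal A$, such that for all $i\in I$ and $n\in N$: $S^n_i\le_a S_i$, $T_i\le_a\mathcal A[T^n_i]^{n\in N}$, and $\&\in T_i$. -}

module Defs where

open import Data.Nat using (ℕ)
open import Data.Fin using (Fin)
open import Data.Product using (Σ; _×_; _,_; Σ-syntax)
open import Data.Sum using (_⊎_; inj₁; inj₂; map₂)
open import Data.Unit using (⊤; tt)
open import Data.Empty using (⊥)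
open import Function.Definitions using (Injective)
open import Relation.Binary.PropositionalEquality using (_≡_)

Label : Set
Label = ℕ

-- Equi-recursive session types are regular trees.  Since coinduction
-- (--guardedness) is unavailable, a (possibly infinite) tree is presented
-- as a pointed coalgebra: a set of states, each state carrying one type
-- constructor whose exchanged types and continuations are again states.
-- A branching/selection with index set I = Fin m is given by
--   labels ls : Fin m → Label, payloads ps (the S_i), continuations cs (the T_i).

data GNode (St : Set) : Set where
  end : GNode St
  bra : (m : ℕ) → (Fin m → Label) → (Fin m → St) → (Fin m → St) → GNode St
  sel : (m : ℕ) → (Fin m → Label) → (Fin m → St) → (Fin m → St) → GNode St

mapG : ∀ {A B : Set} → (A → B) → GNode A → GNode B
mapG f end = end
mapG f (bra m ls ps cs) = bra m ls (λ i → f (ps i)) (λ i → f (cs i))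
mapG f (sel m ls ps cs) = sel m ls (λ i → f (ps i)) (λ i → f (cs i))

record Coalg : Set₁ where
  field
    St  : Set
    out : St → GNode St
open Coalg public

record Ty : Set₁ where
  constructor _▸_
  field
    C  : Coalg
    at : St C
open Ty public

-- Closed session types: regular trees with pairwise distinct labels,
-- i.e. finite coalgebras (states Fin k).  Contractiveness is automatic.

DistinctLabels : ∀ {St} → GNode St → Set
DistinctLabels end = ⊤
DistinctLabels (bra m ls ps cs) = Injective _≡_ _≡_ ls
DistinctLabels (sel m ls ps cs) = Injective _≡_ _≡_ ls

record Closed : Set where
  field
    size     : ℕ
    graph    : Fin size → GNode (Fin size)
    distinct : ∀ s → DistinctLabels (graph s)
    root     : Fin size
open Closed public

⟦_⟧ : Closed → Ty
⟦ T ⟧ = record { St = Fin (size T) ; out = graph T } ▸ root T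

-- The predicate & ∈ T : every continuation path of T contains a branching
-- (inductive, so every such path reaches a branching in finitely many steps).

data BrIn (C : Coalg) : St C → Set where
  br : ∀ {s m ls ps cs} → out C s ≡ bra m ls ps cs → BrIn C s
  sl : ∀ {s m ls ps cs} → out C s ≡ sel m ls ps cs → ((i : Fin m) → BrIn C (cs i)) → BrIn C s

&∈ : Ty → Set
&∈ (C ▸ s) = BrIn C s

-- Asynchronous contexts.  A decomposition S = 𝒜[U_n]^{n∈N} of the tree at
-- state s is a finite prefix of branchings of that tree; the holes are the
-- subtrees where the prefix stops.

module Ctx (C : Coalg) where

  data Prefix : St C → Set where
    hole : ∀ {s} → Prefix s
    deep : ∀ {s m ls ps cs} → out C s ≡ bra m ls ps cs → ((i : Fin m) → Prefix (cs i)) → Prefix s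

  -- & ∈ 𝒜 : the context is not a single hole
  NotHole : ∀ {s} → Prefix s → Set
  NotHole hole = ⊥
  NotHole (deep _ _) = ⊤

  Holes : ∀ {s} → Prefix s → (St C → Set) → Set
  Holes {s} hole X = X s
  Holes (deep _ k) X = ∀ i → Holes (k i) X

  AllHoles : ∀ {s} (P : Prefix s) {X : St C → Set} → Holes P X → (∀ {u} → X u → Set) → Set
  AllHoles hole w Q = Q w
  AllHoles (deep _ k) w Q = ∀ i → AllHoles (k i) (w i) Q

  data HasSel (l : Label) (u : St C) : Set where
    has : ∀ {m ls ps cs} → out C u ≡ sel m ls ps cs → (j : Fin m) → ls j ≡ l → HasSel l u

  selPayload : ∀ {l u} → HasSel l u → St C
  selPayload (has {ps = ps} _ j _) = ps j

  selCont : ∀ {l u} → HasSel l u → St C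
  selCont (has {cs = cs} _ j _) = cs j

  Pos : ∀ {s} → Prefix s → Set
  Pos hole = ⊥
  Pos (deep {m = m} _ k) = ⊤ ⊎ Σ[ i ∈ Fin m ] Pos (k i)

  -- the tree 𝒜[T^n_l]^{n∈N}: states are the old states plus the context nodes
  module _ (l : Label) where

    Plug : ∀ {s} → Prefix s → Set
    Plug P = St C ⊎ Pos P

    top : ∀ {s} (P : Prefix s) → Holes P (HasSel l) → Plug P
    top hole w = inj₁ (selCont w)
    top (deep _ _) w = inj₂ (inj₁ tt)

    nodeAt : ∀ {s} (P : Prefix s) → Holes P (HasSel l) → Pos P → GNode (Plug P)
    nodeAt (deep {m = m} {ls} {ps} _ k) w (inj₁ tt) =
      bra m ls (λ i → inj₁ (ps i)) (λ i → map₂ (λ p → inj₂ (i , p)) (top (k i) (w i)))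
    nodeAt (deep _ k) w (inj₂ (i , p)) = mapG (map₂ (λ q → inj₂ (i , q))) (nodeAt (k i) (w i) p)

    plugOut : ∀ {s} (P : Prefix s) → Holes P (HasSel l) → Plug P → GNode (Plug P)
    plugOut P w (inj₁ u) = mapG inj₁ (out C u)
    plugOut P w (inj₂ p) = nodeAt P w p

    plug : ∀ {s} (P : Prefix s) → Holes P (HasSel l) → Ty
    plug P w = record { St = Plug P ; out = plugOut P w } ▸ top P w

open Ctx public

Rel : Set₁
Rel = Ty → Ty → Set

data Step (R : Rel) (X Y : Ty) : Set where
  end : out (C X) (at X) ≡ end → out (C Y) (at Y) ≡ end → Step R X Y
  bra : ∀ {m ls ps cs m′ ls′ ps′ cs′} →
        out (C X) (at X) ≡ bra m ls ps cs → out (C Y) (at Y) ≡ bra m′ ls′ ps′ cs′ →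
        ((j : Fin m′) → Σ[ i ∈ Fin m ]
            (ls i ≡ ls′ j × R (C X ▸ ps i) (C Y ▸ ps′ j) × R (C X ▸ cs i) (C Y ▸ cs′ j))) →
        Step R X Y
  sel : ∀ {m ls ps cs m′ ls′ ps′ cs′} →
        out (C X) (at X) ≡ sel m ls ps cs → out (C Y) (at Y) ≡ sel m′ ls′ ps′ cs′ →
        ((i : Fin m) → Σ[ j ∈ Fin m′ ]
            (ls′ j ≡ ls i × R (C Y ▸ ps′ j) (C X ▸ ps i) × R (C X ▸ cs i) (C Y ▸ cs′ j))) →
        Step R X Y
  async : ∀ {m ls ps cs} →
        out (C X) (at X) ≡ sel m ls ps cs →
        (P : Prefix (C Y) (at Y)) → NotHole (C Y) P →
        ((i : Fin m) →
           Σ[ w ∈ Holes (C Y) P (HasSel (C Y) (ls i)) ]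
             (AllHoles (C Y) P w (λ h → R (C Y ▸ selPayload (C Y) h) (C X ▸ ps i))
              × R (C X ▸ cs i) (plug (C Y) (ls i) P w)
              × &∈ (C X ▸ cs i))) →
        Step R X Y

-- ≤_a : the largest relation R with R ⊆ Step R (union of all post-fixed points)
_≤a_ : Ty → Ty → Set₁
T ≤a S = Σ[ R ∈ Rel ] ((∀ {X Y} → R X Y → Step R X Y) × R T S)

module Submission where

open import Defs

open import Data.Nat using (ℕ)
open import Data.Fin using (Fin)
open import Data.Product using (Σ; _×_; _,_; Σ-syntax; proj₁; proj₂)
open import Data.Sum using (inj₁; inj₂; map₂)
open import Data.Unit using (tt)
open import Data.Empty using (⊥; ⊥-elim)
open import Relation.Binary.Core using (_⇒_)
open import Relation.Binary.Construct.Union using (_∪_)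
open import Relation.Binary.PropositionalEquality using (_≡_; refl; sym; trans; subst; subst₂)

-- A witness of X ≤a Y is a post-fixed point of Step relating trees of
-- arbitrary coalgebras, and the asynchronous clause relates a continuation
-- to a tree 𝒜[T^n_l] living in a freshly built coalgebra.  To compose two
-- witnesses we therefore work in one universal coalgebra 𝕋 whose states
-- ("trees") are the states of closed types together with explicit
-- branching nodes, so that 𝒜[T^n_l] can be written down inside 𝕋.  Every
-- coalgebra met in the proof (closed types and, iteratively, their
-- pluggings: the universe Code) maps into 𝕋 by a homomorphism, and
-- contexts, hole choices and the predicate & ∈ transfer along
-- homomorphisms in both directions.
--
-- On 𝕋 we define the one-step unfolding TStep of ≤a; Q is a simulation if
-- Q ⊆ TStep Q.  The core lemma (module Composition) states that Q ⨾ Q is a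
-- simulation whenever Q is a simulation closed under the branching rule:
-- matching selections compose directly, and an asynchronous match into a
-- context 𝒜 of the middle type is pushed through the second step by
-- lifting 𝒜 to a context of the right-hand type (liftCtx).  The images in
-- 𝕋 of the two given witnesses form such a Q after branching closure, and
-- the preimage of a simulation on 𝕋 is a post-fixed point of Step; this
-- yields T ≤a S.

data Tree : Set where
  leaf : (K : Closed) → Fin (size K) → Tree
  node : (m : ℕ) → (Fin m → Label) → (Fin m → Tree) → (Fin m → Tree) → Tree

unfold : Tree → GNode Tree
unfold (leaf K s) = mapG (leaf K) (graph K s)
unfold (node m ls ps cs) = bra m ls ps cs

𝕋 : Coalg
𝕋 = record { St = Tree ; out = unfold }

TRel : Set₁
TRel = Tree → Tree → Set

-- Relational composition (the library's _;_ cannot be named, as ';' is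
-- a layout token).
_⨾_ : TRel → TRel → TRel
(Q ⨾ Q′) u v = Σ[ x ∈ Tree ] (Q u x × Q′ x v)

bra≢sel : ∀ {A : Set} {x : GNode A} {m ls ps cs m′ ls′ ps′ cs′} →
          x ≡ bra m ls ps cs → x ≡ sel m′ ls′ ps′ cs′ → ⊥
bra≢sel refl ()

bra≢end : ∀ {A : Set} {x : GNode A} {m ls ps cs} → x ≡ bra m ls ps cs → x ≡ end → ⊥
bra≢end refl ()

sel≢end : ∀ {A : Set} {x : GNode A} {m ls ps cs} → x ≡ sel m ls ps cs → x ≡ end → ⊥
sel≢end refl ()

-- Two presentations of one node (used to identify the node of the middle
-- type as seen by the two composed simulation steps).
SameNode : GNode Tree → GNode Tree → Set
SameNode = _≡_

-- Corr f n o : the tree node n is the image of the node o under f, with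
-- exchanged types and continuations equal pointwise (no function
-- extensionality is available, so this replaces n ≡ mapG f o).
data Corr {A : Set} (f : A → Tree) : GNode Tree → GNode A → Set where
  cend : Corr f end end
  cbra : ∀ {m ls ps cs ps₀ cs₀} → (∀ i → ps i ≡ f (ps₀ i)) → (∀ i → cs i ≡ f (cs₀ i)) →
         Corr f (bra m ls ps cs) (bra m ls ps₀ cs₀)
  csel : ∀ {m ls ps cs ps₀ cs₀} → (∀ i → ps i ≡ f (ps₀ i)) → (∀ i → cs i ≡ f (cs₀ i)) →
         Corr f (sel m ls ps cs) (sel m ls ps₀ cs₀)

record Hom (K : Coalg) : Set where
  constructor hom
  field
    fun  : St K → Tree
    corr : ∀ s → Corr fun (unfold (fun s)) (out K s)
open Hom public

corr-mapG : ∀ {A} {f : A → Tree} (o : GNode A) → Corr f (mapG f o) o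
corr-mapG end = cend
corr-mapG (bra m ls ps cs) = cbra (λ i → refl) (λ i → refl)
corr-mapG (sel m ls ps cs) = csel (λ i → refl) (λ i → refl)

corr-rename : ∀ {A B} {f : A → Tree} {n o} → Corr f n o → (φ : A → B) (f′ : B → Tree) →
              (∀ a → f′ (φ a) ≡ f a) → Corr f′ n (mapG φ o)
corr-rename cend φ f′ eq = cend
corr-rename (cbra pe ce) φ f′ eq = cbra (λ i → trans (pe i) (sym (eq _))) (λ i → trans (ce i) (sym (eq _)))
corr-rename (csel pe ce) φ f′ eq = csel (λ i → trans (pe i) (sym (eq _))) (λ i → trans (ce i) (sym (eq _)))

corr-at : ∀ {K} (g : Hom K) {y v} → fun g y ≡ v → Corr (fun g) (unfold v) (out K y)
corr-at g {y} refl = corr g y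

image-end : ∀ {A} {f : A → Tree} {n o} → Corr f n o → o ≡ end → n ≡ end
image-end cend refl = refl

image-bra : ∀ {A} {f : A → Tree} {n o m ls ps₀ cs₀} → Corr f n o → o ≡ bra m ls ps₀ cs₀ →
            Σ[ ps ∈ (Fin m → Tree) ] Σ[ cs ∈ (Fin m → Tree) ]
              (n ≡ bra m ls ps cs × (∀ i → ps i ≡ f (ps₀ i)) × (∀ i → cs i ≡ f (cs₀ i)))
image-bra (cbra {ps = ps} {cs = cs} pe ce) refl = ps , cs , refl , pe , ce

image-sel : ∀ {A} {f : A → Tree} {n o m ls ps₀ cs₀} → Corr f n o → o ≡ sel m ls ps₀ cs₀ →
            Σ[ ps ∈ (Fin m → Tree) ] Σ[ cs ∈ (Fin m → Tree) ]
              (n ≡ sel m ls ps cs × (∀ i → ps i ≡ f (ps₀ i)) × (∀ i → cs i ≡ f (cs₀ i)))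
image-sel (csel {ps = ps} {cs = cs} pe ce) refl = ps , cs , refl , pe , ce

preimage-end : ∀ {A} {f : A → Tree} {n o} → Corr f n o → n ≡ end → o ≡ end
preimage-end cend refl = refl

preimage-bra : ∀ {A} {f : A → Tree} {n o m ls ps cs} → Corr f n o → n ≡ bra m ls ps cs →
               Σ[ ps₀ ∈ (Fin m → A) ] Σ[ cs₀ ∈ (Fin m → A) ]
                 (o ≡ bra m ls ps₀ cs₀ × (∀ i → ps i ≡ f (ps₀ i)) × (∀ i → cs i ≡ f (cs₀ i)))
preimage-bra (cbra {ps₀ = ps₀} {cs₀ = cs₀} pe ce) refl = ps₀ , cs₀ , refl , pe , ce

preimage-sel : ∀ {A} {f : A → Tree} {n o m ls ps cs} → Corr f n o → n ≡ sel m ls ps cs →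
               Σ[ ps₀ ∈ (Fin m → A) ] Σ[ cs₀ ∈ (Fin m → A) ]
                 (o ≡ sel m ls ps₀ cs₀ × (∀ i → ps i ≡ f (ps₀ i)) × (∀ i → cs i ≡ f (cs₀ i)))
preimage-sel (csel {ps₀ = ps₀} {cs₀ = cs₀} pe ce) refl = ps₀ , cs₀ , refl , pe , ce

&∈-push : ∀ {K} (g : Hom K) {s} → BrIn K s → BrIn 𝕋 (fun g s)
&∈-push g {s} (br e) with image-bra (corr g s) e
... | _ , _ , e′ , _ , _ = br e′
&∈-push g {s} (sl e brs) with image-sel (corr g s) e
... | _ , _ , e′ , _ , ce = sl e′ (λ i → subst (BrIn 𝕋) (sym (ce i)) (&∈-push g (brs i)))

&∈-pull : ∀ {K} (g : Hom K) {s v} → BrIn 𝕋 v → fun g s ≡ v → BrIn K s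
&∈-pull g (br e′) eq with preimage-bra (corr-at g eq) e′
... | _ , _ , e , _ , _ = br e
&∈-pull g (sl e′ brs) eq with preimage-sel (corr-at g eq) e′
... | _ , _ , e , _ , ce = sl e (λ i → &∈-pull g (brs i) (sym (ce i)))

-- 𝒜[T^n_l]^{n∈N} inside 𝕋: the branchings of the context become nodes.
plugTree : (l : Label) → ∀ {s} (A : Prefix 𝕋 s) → Holes 𝕋 A (HasSel 𝕋 l) → Tree
plugTree l hole w = selCont 𝕋 w
plugTree l (deep {m = m} {ls} {ps} e k) w = node m ls ps (λ i → plugTree l (k i) (w i))

-- Contexts, hole choices and pluggings transferred along g, in both
-- directions: steps of the given witnesses are read in 𝕋 by pushing, and
-- steps in 𝕋 are read back by pulling.
module Transport {K : Coalg} (g : Hom K) where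
  private
    f : St K → Tree
    f = fun g

  data Match : ∀ {y} → Prefix K y → ∀ {v} → Prefix 𝕋 v → Set where
    mhole : ∀ {y v} → f y ≡ v → Match (hole {K} {y}) (hole {𝕋} {v})
    mdeep : ∀ {y v m ls ps cs ps′ cs′} {e : out K y ≡ bra m ls ps cs} {e′ : unfold v ≡ bra m ls ps′ cs′}
              {k : (i : Fin m) → Prefix K (cs i)} {k′ : (i : Fin m) → Prefix 𝕋 (cs′ i)} →
            (∀ i → ps′ i ≡ f (ps i)) → (∀ i → Match (k i) (k′ i)) →
            Match (deep {K} {y} e k) (deep {𝕋} {v} e′ k′)

  HoleMatch : ∀ {l y v} {P : Prefix K y} {A : Prefix 𝕋 v} → Match P A →
              Holes K P (HasSel K l) → Holes 𝕋 A (HasSel 𝕋 l) → Set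
  HoleMatch (mhole _) w w′ = (selPayload 𝕋 w′ ≡ f (selPayload K w)) × (selCont 𝕋 w′ ≡ f (selCont K w))
  HoleMatch (mdeep _ mk) w w′ = ∀ i → HoleMatch (mk i) (w i) (w′ i)

  pushCtx : ∀ {y} (P : Prefix K y) {v} → f y ≡ v → Σ[ A ∈ Prefix 𝕋 v ] Match P A
  pushCtx hole eq = hole , mhole eq
  pushCtx (deep e k) eq with image-bra (corr-at g eq) e
  ... | _ , _ , e′ , pe , ce =
    deep e′ (λ i → proj₁ (pushCtx (k i) (sym (ce i)))) , mdeep pe (λ i → proj₂ (pushCtx (k i) (sym (ce i))))

  pullCtx : ∀ {y v} (A : Prefix 𝕋 v) → f y ≡ v → Σ[ P ∈ Prefix K y ] Match P A
  pullCtx hole eq = hole , mhole eq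
  pullCtx (deep e′ k′) eq with preimage-bra (corr-at g eq) e′
  ... | _ , _ , e , pe , ce =
    deep e (λ i → proj₁ (pullCtx (k′ i) (sym (ce i)))) , mdeep pe (λ i → proj₂ (pullCtx (k′ i) (sym (ce i))))

  pushHoles : ∀ {l y v} {P : Prefix K y} {A : Prefix 𝕋 v} (mt : Match P A) (w : Holes K P (HasSel K l)) →
              Σ[ w′ ∈ Holes 𝕋 A (HasSel 𝕋 l) ] HoleMatch mt w w′
  pushHoles (mhole eq) (has e j p) with image-sel (corr-at g eq) e
  ... | _ , _ , e′ , pe , ce = has e′ j p , pe j , ce j
  pushHoles (mdeep _ mk) w = (λ i → proj₁ (pushHoles (mk i) (w i))) , (λ i → proj₂ (pushHoles (mk i) (w i)))

  pullHoles : ∀ {l y v} {P : Prefix K y} {A : Prefix 𝕋 v} (mt : Match P A) (w′ : Holes 𝕋 A (HasSel 𝕋 l)) →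
              Σ[ w ∈ Holes K P (HasSel K l) ] HoleMatch mt w w′
  pullHoles (mhole eq) (has e′ j p) with preimage-sel (corr-at g eq) e′
  ... | _ , _ , e , pe , ce = has e j p , pe j , ce j
  pullHoles (mdeep _ mk) w′ = (λ i → proj₁ (pullHoles (mk i) (w′ i))) , (λ i → proj₂ (pullHoles (mk i) (w′ i)))

  notHole-push : ∀ {y v} {P : Prefix K y} {A : Prefix 𝕋 v} → Match P A → NotHole K P → NotHole 𝕋 A
  notHole-push (mdeep _ _) _ = tt

  notHole-pull : ∀ {y v} {P : Prefix K y} {A : Prefix 𝕋 v} → Match P A → NotHole 𝕋 A → NotHole K P
  notHole-pull (mdeep _ _) _ = tt

  allHoles-push : ∀ {l y v} {P : Prefix K y} {A : Prefix 𝕋 v} (mt : Match P A) {w w′} → HoleMatch mt w w′ →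
                  {Q : ∀ {u} → HasSel K l u → Set} {Q′ : ∀ {u} → HasSel 𝕋 l u → Set} →
                  (∀ {a b} (h : HasSel K l a) (h′ : HasSel 𝕋 l b) →
                     selPayload 𝕋 h′ ≡ f (selPayload K h) → Q h → Q′ h′) →
                  AllHoles K P w Q → AllHoles 𝕋 A w′ Q′
  allHoles-push (mhole _) (pe , _) tr q = tr _ _ pe q
  allHoles-push (mdeep _ mk) mw tr q = λ i → allHoles-push (mk i) (mw i) tr (q i)

  allHoles-pull : ∀ {l y v} {P : Prefix K y} {A : Prefix 𝕋 v} (mt : Match P A) {w w′} → HoleMatch mt w w′ →
                  {Q : ∀ {u} → HasSel K l u → Set} {Q′ : ∀ {u} → HasSel 𝕋 l u → Set} →
                  (∀ {a b} (h : HasSel K l a) (h′ : HasSel 𝕋 l b) →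
                     selPayload 𝕋 h′ ≡ f (selPayload K h) → Q′ h′ → Q h) →
                  AllHoles 𝕋 A w′ Q′ → AllHoles K P w Q
  allHoles-pull (mhole _) (pe , _) tr q = tr _ _ pe q
  allHoles-pull (mdeep _ mk) mw tr q = λ i → allHoles-pull (mk i) (mw i) tr (q i)

  module _ (l : Label) where
    posTree : ∀ {y v} {P : Prefix K y} {A : Prefix 𝕋 v} → Match P A → Holes 𝕋 A (HasSel 𝕋 l) → Pos K P → Tree
    posTree (mdeep {v = v} {e′ = e′} {k′ = k′} _ _) w′ (inj₁ tt) = plugTree l (deep {𝕋} {v} e′ k′) w′
    posTree (mdeep _ mk) w′ (inj₂ (i , p)) = posTree (mk i) (w′ i) p

    plugFun : ∀ {y v} {P : Prefix K y} {A : Prefix 𝕋 v} → Match P A → Holes 𝕋 A (HasSel 𝕋 l) → Plug K l P → Tree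
    plugFun mt w′ (inj₁ u) = f u
    plugFun mt w′ (inj₂ p) = posTree mt w′ p

    plugFun-top : ∀ {y v} {P : Prefix K y} {A : Prefix 𝕋 v} (mt : Match P A) w w′ → HoleMatch mt w w′ →
                  plugTree l A w′ ≡ plugFun mt w′ (top K l P w)
    plugFun-top (mhole _) w w′ (_ , ce) = ce
    plugFun-top (mdeep _ _) w w′ _ = refl

    node-corr : ∀ {y v} {P : Prefix K y} {A : Prefix 𝕋 v} (mt : Match P A) w w′ → HoleMatch mt w w′ →
                (p : Pos K P) → Corr (plugFun mt w′) (unfold (posTree mt w′ p)) (nodeAt K l P w p)
    node-corr (mdeep pe mk) w w′ mw (inj₁ tt) =
      cbra pe (λ i → trans (plugFun-top (mk i) (w i) (w′ i) (mw i)) (descend i (top K l _ (w i))))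
      where
        descend : ∀ i x → plugFun (mk i) (w′ i) x ≡ plugFun (mdeep pe mk) w′ (map₂ (λ p → inj₂ (i , p)) x)
        descend i (inj₁ u) = refl
        descend i (inj₂ q) = refl
    node-corr (mdeep pe mk) w w′ mw (inj₂ (i , p)) =
      corr-rename (node-corr (mk i) (w i) (w′ i) (mw i) p) (map₂ (λ q → inj₂ (i , q))) (plugFun (mdeep pe mk) w′) ascend
      where
        ascend : ∀ x → plugFun (mdeep pe mk) w′ (map₂ (λ q → inj₂ (i , q)) x) ≡ plugFun (mk i) (w′ i) x
        ascend (inj₁ u) = refl
        ascend (inj₂ q) = refl

    plugHom : ∀ {y v} {P : Prefix K y} {A : Prefix 𝕋 v} (mt : Match P A) w w′ → HoleMatch mt w w′ →
              Hom (C (plug K l P w))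
    plugHom mt w w′ mw = hom (plugFun mt w′) corr-plug
      where
        corr-plug : ∀ s → Corr (plugFun mt w′) (unfold (plugFun mt w′ s)) (plugOut K l _ w s)
        corr-plug (inj₁ u) = corr-rename (corr g u) inj₁ (plugFun mt w′) (λ a → refl)
        corr-plug (inj₂ p) = node-corr mt w w′ mw p

  pushedCtx : ∀ {y} (P : Prefix K y) → Prefix 𝕋 (f y)
  pushedCtx P = proj₁ (pushCtx P refl)

  pushedMatch : ∀ {y} (P : Prefix K y) → Match P (pushedCtx P)
  pushedMatch P = proj₂ (pushCtx P refl)

  module Pushed {y} (P : Prefix K y) (l : Label) (w : Holes K P (HasSel K l)) where
    holes : Holes 𝕋 (pushedCtx P) (HasSel 𝕋 l)
    holes = proj₁ (pushHoles (pushedMatch P) w)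

    holeMatch : HoleMatch (pushedMatch P) w holes
    holeMatch = proj₂ (pushHoles (pushedMatch P) w)

    pushedHom : Hom (C (plug K l P w))
    pushedHom = plugHom l (pushedMatch P) w holes holeMatch

    pushedHom-top : fun pushedHom (top K l P w) ≡ plugTree l (pushedCtx P) holes
    pushedHom-top = sym (plugFun-top l (pushedMatch P) w holes holeMatch)

BraMatch : TRel → ∀ {m m′} → (Fin m → Label) → (Fin m → Tree) → (Fin m → Tree) →
           (Fin m′ → Label) → (Fin m′ → Tree) → (Fin m′ → Tree) → Set
BraMatch R {m} {m′} ls ps cs ls′ ps′ cs′ =
  (j : Fin m′) → Σ[ i ∈ Fin m ] (ls i ≡ ls′ j × R (ps i) (ps′ j) × R (cs i) (cs′ j))

SelMatch : TRel → ∀ {m m′} → (Fin m → Label) → (Fin m → Tree) → (Fin m → Tree) →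
           (Fin m′ → Label) → (Fin m′ → Tree) → (Fin m′ → Tree) → Set
SelMatch R {m} {m′} ls ps cs ls′ ps′ cs′ =
  (i : Fin m) → Σ[ j ∈ Fin m′ ] (ls′ j ≡ ls i × R (ps′ j) (ps i) × R (cs i) (cs′ j))

AsyncMatch : TRel → ∀ {b} → Prefix 𝕋 b → Label → Tree → Tree → Set
AsyncMatch R B l p c = Σ[ w ∈ Holes 𝕋 B (HasSel 𝕋 l) ]
  (AllHoles 𝕋 B w (λ h → R (selPayload 𝕋 h) p) × R c (plugTree l B w) × BrIn 𝕋 c)

data TStep (R : TRel) (u v : Tree) : Set where
  end   : unfold u ≡ end → unfold v ≡ end → TStep R u v
  bra   : ∀ {m ls ps cs m′ ls′ ps′ cs′} → unfold u ≡ bra m ls ps cs → unfold v ≡ bra m′ ls′ ps′ cs′ →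
          BraMatch R ls ps cs ls′ ps′ cs′ → TStep R u v
  sel   : ∀ {m ls ps cs m′ ls′ ps′ cs′} → unfold u ≡ sel m ls ps cs → unfold v ≡ sel m′ ls′ ps′ cs′ →
          SelMatch R ls ps cs ls′ ps′ cs′ → TStep R u v
  async : ∀ {m ls ps cs} → unfold u ≡ sel m ls ps cs → (B : Prefix 𝕋 v) → NotHole 𝕋 B →
          ((i : Fin m) → AsyncMatch R B (ls i) (ps i) (cs i)) → TStep R u v

allHoles-map : ∀ {K : Coalg} {X : St K → Set} {s} (A : Prefix K s) (w : Holes K A X)
               {Q Q′ : ∀ {u} → X u → Set} → (∀ {u} (h : X u) → Q h → Q′ h) →
               AllHoles K A w Q → AllHoles K A w Q′
allHoles-map hole w tr q = tr w q
allHoles-map (deep _ k) w tr q = λ i → allHoles-map (k i) (w i) tr (q i)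

tstep-map : ∀ {R R′ : TRel} → R ⇒ R′ → TStep R ⇒ TStep R′
tstep-map t (end e₁ e₂) = end e₁ e₂
tstep-map t (bra e₁ e₂ f) = bra e₁ e₂ λ j → let (i , l , p , c) = f j in i , l , t p , t c
tstep-map t (sel e₁ e₂ f) = sel e₁ e₂ λ i → let (j , l , p , c) = f i in j , l , t p , t c
tstep-map t (async e B nh f) = async e B nh λ i →
  let (w , ps , c , b) = f i in w , allHoles-map B w (λ h → t) ps , t c , b

Simulation : TRel → Set
Simulation Q = Q ⇒ TStep Q

-- needed to treat the two given witnesses as a single relation
∪-simulation : ∀ {Q₁ Q₂} → Simulation Q₁ → Simulation Q₂ → Simulation (Q₁ ∪ Q₂)
∪-simulation s₁ s₂ (inj₁ q) = tstep-map inj₁ (s₁ q)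
∪-simulation s₁ s₂ (inj₂ q) = tstep-map inj₂ (s₂ q)

BranchClosed : TRel → Set
BranchClosed Q = ∀ {a b m ls ps cs m′ ls′ ps′ cs′} → unfold a ≡ bra m ls ps cs → unfold b ≡ bra m′ ls′ ps′ cs′ →
                 BraMatch Q ls ps cs ls′ ps′ cs′ → Q a b

-- The least branching-closed relation containing R; lifting a context
-- through a simulation step produces branchings related only in this way.
data BrClo (R : TRel) : TRel where
  base   : ∀ {a b} → R a b → BrClo R a b
  branch : BranchClosed (BrClo R)

brClo-simulation : ∀ {R} → Simulation R → Simulation (BrClo R)
brClo-simulation s (base r) = tstep-map base (s r)
brClo-simulation s (branch e₁ e₂ f) = bra e₁ e₂ f

module Composition (Q : TRel) (Q-sim : Simulation Q) (Q-branch : BranchClosed Q) where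

  -- & ∈ is reflected along Q: a tree below a branching is a branching
  -- or (asynchronous clause) a selection whose continuations satisfy & ∈;
  -- a tree below a selection is a selection with matching continuations.
  mutual
    &∈-back : ∀ {a b} → Q a b → BrIn 𝕋 b → BrIn 𝕋 a
    &∈-back q (br eb) = &∈-back-bra eb (Q-sim q)
    &∈-back q (sl eb brs) = &∈-back-sel eb brs (Q-sim q)

    &∈-back-bra : ∀ {a b m ls ps cs} → unfold b ≡ bra m ls ps cs → TStep Q a b → BrIn 𝕋 a
    &∈-back-bra eb (end _ e₂) = ⊥-elim (bra≢end eb e₂)
    &∈-back-bra eb (bra e₁ _ _) = br e₁
    &∈-back-bra eb (sel _ e₂ _) = ⊥-elim (bra≢sel eb e₂)
    &∈-back-bra eb (async e₁ _ _ f) = sl e₁ (λ i → proj₂ (proj₂ (proj₂ (f i))))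

    &∈-back-sel : ∀ {a b m ls ps cs} → unfold b ≡ sel m ls ps cs → ((i : Fin m) → BrIn 𝕋 (cs i)) →
                  TStep Q a b → BrIn 𝕋 a
    &∈-back-sel eb brs (end _ e₂) = ⊥-elim (sel≢end eb e₂)
    &∈-back-sel eb brs (bra _ e₂ _) = ⊥-elim (bra≢sel e₂ eb)
    &∈-back-sel eb brs (sel e₁ e₂ f) = &∈-back-sel-sel e₁ f brs (trans (sym eb) e₂)
    &∈-back-sel eb brs (async e₁ hole () _)
    &∈-back-sel eb brs (async e₁ (deep e′ _) _ _) = ⊥-elim (bra≢sel e′ eb)

    &∈-back-sel-sel : ∀ {a m ls ps cs m₁ ls₁ ps₁ cs₁ m′ ls′ ps′ cs′} → unfold a ≡ sel m ls ps cs →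
                      SelMatch Q ls ps cs ls′ ps′ cs′ → ((j : Fin m₁) → BrIn 𝕋 (cs₁ j)) →
                      SameNode (sel m₁ ls₁ ps₁ cs₁) (sel m′ ls′ ps′ cs′) → BrIn 𝕋 a
    &∈-back-sel-sel e₁ f brs refl = sl e₁ λ i → &∈-back (proj₂ (proj₂ (proj₂ (f i)))) (brs (proj₁ (f i)))

  record LiftedHoles {a b} (A : Prefix 𝕋 a) (B : Prefix 𝕋 b) (l : Label) (p : Tree)
                     (w : Holes 𝕋 A (HasSel 𝕋 l)) : Set where
    constructor lifted
    field
      holes    : Holes 𝕋 B (HasSel 𝕋 l)
      payloads : AllHoles 𝕋 B holes (λ h → (Q ⨾ Q) (selPayload 𝕋 h) p)
      plugged  : Q (plugTree l A w) (plugTree l B holes)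
  open LiftedHoles

  record Lift {a} (A : Prefix 𝕋 a) (b : Tree) : Set where
    field
      ctx     : Prefix 𝕋 b
      notHole : NotHole 𝕋 A → NotHole 𝕋 ctx
      lift    : ∀ l p w → AllHoles 𝕋 A w (λ h → Q (selPayload 𝕋 h) p) → LiftedHoles A ctx l p w
  open Lift

  lift-sel : ∀ {a b l p m ls ps cs m₁ ls₁ ps₁ cs₁ m′ ls′ ps′ cs′}
             (e : unfold a ≡ sel m ls ps cs) (j : Fin m) (q : ls j ≡ l) →
             unfold b ≡ sel m′ ls′ ps′ cs′ → SelMatch Q ls₁ ps₁ cs₁ ls′ ps′ cs′ → Q (ps j) p →
             SameNode (sel m ls ps cs) (sel m₁ ls₁ ps₁ cs₁) → LiftedHoles (hole {𝕋} {a}) (hole {𝕋} {b}) l p (has e j q)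
  lift-sel {ps₁ = ps₁} e j q e′ f pq refl with f j
  ... | j′ , le , pq′ , cq = lifted (has e′ j′ (trans le q)) (ps₁ j , pq′ , pq) cq

  lift-async : ∀ {a b l p m ls ps cs m₁ ls₁ ps₁ cs₁}
               (e : unfold a ≡ sel m ls ps cs) (j : Fin m) (q : ls j ≡ l) (B : Prefix 𝕋 b) →
               ((i : Fin m₁) → AsyncMatch Q B (ls₁ i) (ps₁ i) (cs₁ i)) → Q (ps j) p →
               SameNode (sel m ls ps cs) (sel m₁ ls₁ ps₁ cs₁) → LiftedHoles (hole {𝕋} {a}) B l p (has e j q)
  lift-async {ps₁ = ps₁} e j refl B f pq refl with f j
  ... | w , al , cq , _ = lifted w (allHoles-map B w (λ h q′ → ps₁ j , q′ , pq) al) cq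

  lift-hole : ∀ {a b} → TStep Q a b → Lift (hole {𝕋} {a}) b
  lift-hole (end e₁ _) = record
    { ctx = hole ; notHole = λ () ; lift = λ { l p (has e j q) _ → ⊥-elim (sel≢end e e₁) } }
  lift-hole (bra e₁ _ _) = record
    { ctx = hole ; notHole = λ () ; lift = λ { l p (has e j q) _ → ⊥-elim (bra≢sel e₁ e) } }
  lift-hole (sel e₁ e₂ f) = record
    { ctx = hole ; notHole = λ () ; lift = λ { l p (has e j q) pq → lift-sel e j q e₂ f pq (trans (sym e) e₁) } }
  lift-hole (async e₁ B _ f) = record
    { ctx = B ; notHole = λ () ; lift = λ { l p (has e j q) pq → lift-async e j q B f pq (trans (sym e) e₁) } }

  mutual
    liftCtx : ∀ {a b} (A : Prefix 𝕋 a) → Q a b → Lift A b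
    liftCtx hole q = lift-hole (Q-sim q)
    liftCtx (deep e k) q = lift-deep e k (Q-sim q)

    lift-deep : ∀ {a b m ls ps cs} (e : unfold a ≡ bra m ls ps cs) (k : (i : Fin m) → Prefix 𝕋 (cs i)) →
                TStep Q a b → Lift (deep {𝕋} {a} e k) b
    lift-deep e k (end e₁ _) = ⊥-elim (bra≢end e e₁)
    lift-deep e k (sel e₁ _ _) = ⊥-elim (bra≢sel e e₁)
    lift-deep e k (async e₁ _ _ _) = ⊥-elim (bra≢sel e e₁)
    lift-deep e k (bra e₁ e₂ f) = lift-bra e k e₂ f (trans (sym e) e₁)

    -- a branching of the context: lift every matched subcontext, and
    -- relate the pluggings by the branching closure of Q
    lift-bra : ∀ {a b m ls ps cs m₁ ls₁ ps₁ cs₁ m′ ls′ ps′ cs′}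
               (e : unfold a ≡ bra m ls ps cs) (k : (i : Fin m) → Prefix 𝕋 (cs i)) →
               unfold b ≡ bra m′ ls′ ps′ cs′ → BraMatch Q ls₁ ps₁ cs₁ ls′ ps′ cs′ →
               SameNode (bra m ls ps cs) (bra m₁ ls₁ ps₁ cs₁) → Lift (deep {𝕋} {a} e k) b
    lift-bra {a = a} {cs′ = cs′} e k e′ f refl = record
      { ctx     = deep e′ (λ j → ctx (sub j))
      ; notHole = λ _ → tt
      ; lift    = λ l p w pq → lifted
          (λ j → holes (lift-at l p w pq j))
          (λ j → payloads (lift-at l p w pq j))
          (Q-branch refl refl λ j →
             src j , proj₁ (proj₂ (f j)) , proj₁ (proj₂ (proj₂ (f j))) , plugged (lift-at l p w pq j))
      }
      where
        src : ∀ j → Fin _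
        src j = proj₁ (f j)

        sub : ∀ j → Lift (k (src j)) (cs′ j)
        sub j = liftCtx (k (src j)) (proj₂ (proj₂ (proj₂ (f j))))

        lift-at : ∀ l p (w : Holes 𝕋 (deep {𝕋} {a} e k) (HasSel 𝕋 l)) →
                  AllHoles 𝕋 (deep {𝕋} {a} e k) w (λ h → Q (selPayload 𝕋 h) p) →
                  ∀ j → LiftedHoles (k (src j)) (ctx (sub j)) l p (w (src j))
        lift-at l p w pq j = lift (sub j) l p (w (src j)) (pq (src j))

  -- A first step of shape end, bra or sel forces the second step's shape
  -- (up to async after sel); matches then compose through the middle node.
  compose-end : ∀ {u x v} → unfold u ≡ end → unfold x ≡ end → TStep Q x v → TStep (Q ⨾ Q) u v
  compose-end e₁ e₂ (end _ e₄) = end e₁ e₄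
  compose-end e₁ e₂ (bra e₃ _ _) = ⊥-elim (bra≢end e₃ e₂)
  compose-end e₁ e₂ (sel e₃ _ _) = ⊥-elim (sel≢end e₃ e₂)
  compose-end e₁ e₂ (async e₃ _ _ _) = ⊥-elim (sel≢end e₃ e₂)

  compose-bra-bra : ∀ {u v mu lsu psu csu mv lsv psv csv mx lsx psx csx mx′ lsx′ psx′ csx′} →
                    unfold u ≡ bra mu lsu psu csu → unfold v ≡ bra mv lsv psv csv →
                    BraMatch Q lsu psu csu lsx psx csx → BraMatch Q lsx′ psx′ csx′ lsv psv csv →
                    SameNode (bra mx lsx psx csx) (bra mx′ lsx′ psx′ csx′) → TStep (Q ⨾ Q) u v
  compose-bra-bra {psx = psx} {csx = csx} e₁ e₂ f g refl = bra e₁ e₂ λ k →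
    let (j , l₂ , p₂ , c₂) = g k
        (i , l₁ , p₁ , c₁) = f j
    in i , trans l₁ l₂ , (psx j , p₁ , p₂) , (csx j , c₁ , c₂)

  compose-bra : ∀ {u x v mu lsu psu csu mx lsx psx csx} →
                unfold u ≡ bra mu lsu psu csu → unfold x ≡ bra mx lsx psx csx →
                BraMatch Q lsu psu csu lsx psx csx → TStep Q x v → TStep (Q ⨾ Q) u v
  compose-bra e₁ e₂ f (end e₃ _) = ⊥-elim (bra≢end e₂ e₃)
  compose-bra e₁ e₂ f (sel e₃ _ _) = ⊥-elim (bra≢sel e₂ e₃)
  compose-bra e₁ e₂ f (async e₃ _ _ _) = ⊥-elim (bra≢sel e₂ e₃)
  compose-bra e₁ e₂ f (bra e₃ e₄ g) = compose-bra-bra e₁ e₄ f g (trans (sym e₂) e₃)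

  -- payloads are contravariant, so they compose in the opposite order
  compose-sel-sel : ∀ {u v mu lsu psu csu mv lsv psv csv mx lsx psx csx mx′ lsx′ psx′ csx′} →
                    unfold u ≡ sel mu lsu psu csu → unfold v ≡ sel mv lsv psv csv →
                    SelMatch Q lsu psu csu lsx psx csx → SelMatch Q lsx′ psx′ csx′ lsv psv csv →
                    SameNode (sel mx lsx psx csx) (sel mx′ lsx′ psx′ csx′) → TStep (Q ⨾ Q) u v
  compose-sel-sel {psx = psx} {csx = csx} e₁ e₂ f g refl = sel e₁ e₂ λ i →
    let (j , l₁ , p₁ , c₁) = f i
        (k , l₂ , p₂ , c₂) = g j
    in k , trans l₂ l₁ , (psx j , p₂ , p₁) , (csx j , c₁ , c₂)

  -- a selection matched by a selection that is then anticipated over B is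
  -- itself anticipated over B, since & ∈ reflects along Q
  compose-sel-async : ∀ {u v mu lsu psu csu mx lsx psx csx mx′ lsx′ psx′ csx′} →
                      unfold u ≡ sel mu lsu psu csu → SelMatch Q lsu psu csu lsx psx csx →
                      (B : Prefix 𝕋 v) → NotHole 𝕋 B →
                      ((j : Fin mx′) → AsyncMatch Q B (lsx′ j) (psx′ j) (csx′ j)) →
                      SameNode (sel mx lsx psx csx) (sel mx′ lsx′ psx′ csx′) → TStep (Q ⨾ Q) u v
  compose-sel-async {psu = psu} {csu = csu} {psx = psx} {csx = csx} e₁ f B nh g refl = async e₁ B nh λ i →
    let (j , l₁ , p₁ , c₁) = f i
        (w , al , c₂ , brx) = g j
    in subst (λ l → AsyncMatch (Q ⨾ Q) B l (psu i) (csu i)) l₁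
         (w , allHoles-map B w (λ h q → psx j , q , p₁) al , (csx j , c₁ , c₂) , &∈-back c₁ brx)

  compose-sel : ∀ {u x v mu lsu psu csu mx lsx psx csx} →
                unfold u ≡ sel mu lsu psu csu → unfold x ≡ sel mx lsx psx csx →
                SelMatch Q lsu psu csu lsx psx csx → TStep Q x v → TStep (Q ⨾ Q) u v
  compose-sel e₁ e₂ f (end e₃ _) = ⊥-elim (sel≢end e₂ e₃)
  compose-sel e₁ e₂ f (bra e₃ _ _) = ⊥-elim (bra≢sel e₃ e₂)
  compose-sel e₁ e₂ f (sel e₃ e₄ g) = compose-sel-sel e₁ e₄ f g (trans (sym e₂) e₃)
  compose-sel e₁ e₂ f (async e₃ B nh g) = compose-sel-async e₁ f B nh g (trans (sym e₂) e₃)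

  -- A first step anticipating over A is answered by lifting A along the
  -- second relation.
  compose : ∀ {u x v} → TStep Q u x → Q x v → TStep (Q ⨾ Q) u v
  compose (end e₁ e₂) q = compose-end e₁ e₂ (Q-sim q)
  compose (bra e₁ e₂ f) q = compose-bra e₁ e₂ f (Q-sim q)
  compose (sel e₁ e₂ f) q = compose-sel e₁ e₂ f (Q-sim q)
  compose (async {ls = ls} {ps = ps} e A nh f) q = async e (ctx L) (notHole L nh) λ i →
    let (w , al , c , brc) = f i
        lifted w′ al′ q′ = lift L (ls i) (ps i) w al
    in w′ , al′ , (plugTree (ls i) A w , c , q′) , brc
    where
      L : Lift A _
      L = liftCtx A q

  ⨾-simulation : Simulation (Q ⨾ Q)
  ⨾-simulation (x , q₁ , q₂) = compose (Q-sim q₁) q₂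

mutual
  data Code : Set where
    closedCode : Closed → Code
    plugCode   : (c : Code) {y : St (coal c)} (l : Label) (P : Prefix (coal c) y) →
                 Holes (coal c) P (HasSel (coal c) l) → Code

  coal : Code → Coalg
  coal (closedCode K) = C ⟦ K ⟧
  coal (plugCode c l P w) = C (plug (coal c) l P w)

codeHom : (c : Code) → Hom (coal c)
codeHom (closedCode K) = hom (leaf K) (λ s → corr-mapG (graph K s))
codeHom (plugCode c l P w) = Transport.Pushed.pushedHom (codeHom c) P l w

data Image (R : Rel) (u v : Tree) : Set where
  image : (c d : Code) {x : St (coal c)} {y : St (coal d)} → R (coal c ▸ x) (coal d ▸ y) →
          fun (codeHom c) x ≡ u → fun (codeHom d) y ≡ v → Image R u v

-- A step of R between coded states is a step of its image; an
-- asynchronous match into P becomes one into the pushed context, whose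
-- plugging is again coded.
image-step : ∀ {R} c d x y → Step R (coal c ▸ x) (coal d ▸ y) →
             TStep (Image R) (fun (codeHom c) x) (fun (codeHom d) y)
image-step c d x y (end e₁ e₂) = end (image-end (corr (codeHom c) x) e₁) (image-end (corr (codeHom d) y) e₂)
image-step c d x y (bra e₁ e₂ f) with image-bra (corr (codeHom c) x) e₁ | image-bra (corr (codeHom d) y) e₂
... | _ , _ , e₁′ , pe , ce | _ , _ , e₂′ , pe′ , ce′ = bra e₁′ e₂′ λ j →
  let (i , l , p , k) = f j
  in i , l , image c d p (sym (pe i)) (sym (pe′ j)) , image c d k (sym (ce i)) (sym (ce′ j))
image-step c d x y (sel e₁ e₂ f) with image-sel (corr (codeHom c) x) e₁ | image-sel (corr (codeHom d) y) e₂
... | _ , _ , e₁′ , pe , ce | _ , _ , e₂′ , pe′ , ce′ = sel e₁′ e₂′ λ i →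
  let (j , l , p , k) = f i
  in j , l , image d c p (sym (pe′ j)) (sym (pe i)) , image c d k (sym (ce i)) (sym (ce′ j))
image-step c d x y (async {ls = ls} e P nh f) with image-sel (corr (codeHom c) x) e
... | _ , _ , e′ , pe , ce = async e′ (pushedCtx P) (notHole-push (pushedMatch P) nh) λ i →
  let (w , al , k , b) = f i
      open Pushed P (ls i) w
  in holes ,
     allHoles-push (pushedMatch P) holeMatch (λ h h′ eq q → image d c q (sym eq) (sym (pe i))) al ,
     image c (plugCode d (ls i) P w) k (sym (ce i)) pushedHom-top ,
     subst (BrIn 𝕋) (sym (ce i)) (&∈-push (codeHom c) b)
  where open Transport (codeHom d)

image-simulation : ∀ {R} → (∀ {X Y} → R X Y → Step R X Y) → Simulation (Image R)
image-simulation post (image c d r refl refl) = image-step c d _ _ (post r)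

data Preimage (Q : TRel) (X Y : Ty) : Set where
  preimage : (f : Hom (C X)) (g : Hom (C Y)) → Q (fun f (at X)) (fun g (at Y)) → Preimage Q X Y

-- A step between images is a step of the preimage; an asynchronous match
-- into a context of 𝕋 is pulled back to a context of Y, whose plugging
-- maps into 𝕋 by plugHom.
preimage-step : ∀ {Q X Y} (f : Hom (C X)) (g : Hom (C Y)) →
                TStep Q (fun f (at X)) (fun g (at Y)) → Step (Preimage Q) X Y
preimage-step {X = X} {Y} f g (end e₁ e₂) = end (preimage-end (corr f (at X)) e₁) (preimage-end (corr g (at Y)) e₂)
preimage-step {Q} {X} {Y} f g (bra e₁ e₂ F) with preimage-bra (corr f (at X)) e₁ | preimage-bra (corr g (at Y)) e₂
... | _ , _ , o₁ , pe , ce | _ , _ , o₂ , pe′ , ce′ = bra o₁ o₂ λ j →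
  let (i , l , p , k) = F j
  in i , l , preimage f g (subst₂ Q (pe i) (pe′ j) p) , preimage f g (subst₂ Q (ce i) (ce′ j) k)
preimage-step {Q} {X} {Y} f g (sel e₁ e₂ F) with preimage-sel (corr f (at X)) e₁ | preimage-sel (corr g (at Y)) e₂
... | _ , _ , o₁ , pe , ce | _ , _ , o₂ , pe′ , ce′ = sel o₁ o₂ λ i →
  let (j , l , p , k) = F i
  in j , l , preimage g f (subst₂ Q (pe′ j) (pe i) p) , preimage f g (subst₂ Q (ce i) (ce′ j) k)
preimage-step {Q} {X} {Y} f g (async {ls = ls} e A nh F) with preimage-sel (corr f (at X)) e
... | _ , _ , o , pe , ce = async o (proj₁ pulled) (notHole-pull mt nh) λ i →
  let (w′ , al , k , b) = F i
      (w , mw) = pullHoles mt w′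
  in w ,
     allHoles-pull mt mw (λ h h′ eq q → preimage g f (subst₂ Q eq (pe i) q)) al ,
     preimage f (plugHom (ls i) mt w w′ mw) (subst₂ Q (ce i) (plugFun-top (ls i) mt w w′ mw) k) ,
     &∈-pull f b (sym (ce i))
  where
    open Transport g
    pulled : Σ[ P ∈ Prefix (C Y) (at Y) ] Match P A
    pulled = pullCtx A refl
    mt : Match (proj₁ pulled) A
    mt = proj₂ pulled

preimage-postfixed : ∀ {Q} → Simulation Q → ∀ {X Y} → Preimage Q X Y → Step (Preimage Q) X Y
preimage-postfixed sim (preimage f g q) = preimage-step f g (sim q)

theorem4p8 : (T V S : Closed) → ⟦ T ⟧ ≤a ⟦ V ⟧ → ⟦ V ⟧ ≤a ⟦ S ⟧ → ⟦ T ⟧ ≤a ⟦ S ⟧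
theorem4p8 T V S (R₁ , post₁ , T≤V) (R₂ , post₂ , V≤S) =
  Preimage (Q ⨾ Q) , preimage-postfixed ⨾-simulation ,
  preimage (codeHom (closedCode T)) (codeHom (closedCode S)) T≤V≤S
  where
    Q : TRel
    Q = BrClo (Image R₁ ∪ Image R₂)

    Q-sim : Simulation Q
    Q-sim = brClo-simulation (∪-simulation (image-simulation post₁) (image-simulation post₂))

    open Composition Q Q-sim branch

    T≤V≤S : (Q ⨾ Q) (leaf T (root T)) (leaf S (root S))
    T≤V≤S = leaf V (root V) ,
            base (inj₁ (image (closedCode T) (closedCode V) T≤V refl refl)) ,
            base (inj₂ (image (closedCode V) (closedCode S) V≤S refl refl))
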